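{- Every complete standard system has contraction $(\mathsf C)$ or weakening $(\mathsf W)$ among its rules.
   Context: Formulas are built from literals (propositional variables $P$ and their complements $\bar P$) using $\wedge$ and $\vee$. Negation satisfies $\neg P=\bar P$ and is extended by De Morgan's laws. A sequent is a nonempty finite multiset of formulas. A comma denotes multiset union, and $\Gamma,\Delta,\Sigma$ denote possibly empty multisets. A formula is valid if it evaluates to $1$ under every $0/1$-assignment. Rules: - Axiom: infer $P,\neg P$ from no premises. - $(\&)$: from $\Gamma,A$ and $\Gamma,B$ infer $\Gamma,A\wedge B$. - $(\otimes)$: from $\Delta,A$ and $\Sigma,B$ infer $\Delta,\Sigma,A\wedge B$. - $(\oplus)$: consists of both $(\oplus_1)$ and $(\oplus_2)$, where $(\oplus_i)$ infers $\Gamma,A_1\vee A_2$ from $\Gamma,A_i$. - $(\mathrm{par})$: from $\Gamma,A,B$ infer $\Gamma,A\vee B$. - $(\mathsf W)$: from $\Gamma$ infer $\Gamma,A$. - $(\mathsf C)$: from $\Gamma,A,A$ infer $\Gamma,A$. A standard system is the axiom together with any subset of $\{(\&),(\otimes),(\oplus),(\mathrm{par}),(\mathsf W),(\mathsf C)\}$. A system is complete if every valid formula is derivable in it. -}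

module Defs where

open import Data.Nat using (ℕ)
open import Data.Bool using (Bool; true; false; not; _∧_; _∨_)
open import Data.List using (List; []; _∷_; _++_)
open import Data.List.Relation.Binary.Permutation.Propositional using (_↭_)
open import Relation.Binary.PropositionalEquality using (_≡_)

data Formula : Set where
  var   : ℕ → Formula
  nvar  : ℕ → Formula
  _and_ : Formula → Formula → Formula
  _or_  : Formula → Formula → Formula

neg : Formula → Formula
neg (var n)   = nvar n
neg (nvar n)  = var n
neg (A and B) = neg A or neg B
neg (A or B)  = neg A and neg B

eval : (ℕ → Bool) → Formula → Bool
eval ρ (var n)   = ρ n
eval ρ (nvar n)  = not (ρ n)
eval ρ (A and B) = eval ρ A ∧ eval ρ B
eval ρ (A or B)  = eval ρ A ∨ eval ρ B

Valid : Formula → Set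
Valid A = ∀ (ρ : ℕ → Bool) → eval ρ A ≡ true

data Rule : Set where
  With Tensor Oplus Par Weak Contr : Rule

-- A standard system: axiom + a subset of the optional rules.
System : Set
System = Rule → Bool

-- Sequents are finite multisets, represented by lists considered up to
-- permutation (the 'exch' constructor).
data Derivable (S : System) : List Formula → Set where
  exch   : ∀ {Γ Δ} → Γ ↭ Δ → Derivable S Γ → Derivable S Δ
  axiom  : ∀ (n : ℕ) → Derivable S (var n ∷ neg (var n) ∷ [])
  with-r : S With ≡ true → ∀ {Γ A B} →
           Derivable S (A ∷ Γ) → Derivable S (B ∷ Γ) → Derivable S ((A and B) ∷ Γ)
  tensor : S Tensor ≡ true → ∀ {Δ Σ A B} →
           Derivable S (A ∷ Δ) → Derivable S (B ∷ Σ) → Derivable S ((A and B) ∷ Δ ++ Σ)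
  oplus₁ : S Oplus ≡ true → ∀ {Γ A B} →
           Derivable S (A ∷ Γ) → Derivable S ((A or B) ∷ Γ)
  oplus₂ : S Oplus ≡ true → ∀ {Γ A B} →
           Derivable S (B ∷ Γ) → Derivable S ((A or B) ∷ Γ)
  par    : S Par ≡ true → ∀ {Γ A B} →
           Derivable S (A ∷ B ∷ Γ) → Derivable S ((A or B) ∷ Γ)
  weak   : S Weak ≡ true → ∀ {Γ A} →
           Derivable S Γ → Derivable S (A ∷ Γ)
  contr  : S Contr ≡ true → ∀ {Γ A} →
           Derivable S (A ∷ A ∷ Γ) → Derivable S (A ∷ Γ)

Complete : System → Set
Complete S = ∀ A → Valid A → Derivable S (A ∷ [])

module Submission where

-- F = P ∨ (Q ∨ (P̄ ∧ (P̄ ∧ Q̄))) is valid, but underivable without (W) and (C) whichever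
-- other rules are present. Without (W) and (C) no premise of a rule is larger than its
-- conclusion (size = number of symbols), and the premises of a rule whose conclusion
-- consists of subformulas of F again consist of subformulas of F. So the derivable
-- multisets of subformulas of F of size at most that of F can be enumerated: there are
-- six of them, closed under all rules, and the singleton F is not among them.

open import Defs
open import Data.Bool using (T; true; false; _≟_)
open import Data.Empty using (⊥-elim)
open import Data.Fin using (Fin; zero; suc; #_)
open import Data.List using (List; []; _∷_; _++_; foldr)
open import Data.List.Relation.Unary.All using (All; []; _∷_)
open import Data.List.Relation.Unary.All.Properties using (++⁻ˡ; ++⁻ʳ)
open import Data.List.Relation.Binary.Permutation.Propositional
  using (_↭_; ↭-sym; refl; prep; swap; trans)
open import Data.List.Relation.Binary.Permutation.Propositional.Properties using (All-resp-↭)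
open import Data.Nat using (ℕ; zero; suc; _+_; _≤_; _≤ᵇ_)
open import Data.Nat.Properties
  using (≤ᵇ⇒≤; ≤⇒≤ᵇ; ≤-trans; ≤-reflexive; +-assoc; +-monoˡ-≤; +-monoʳ-≤;
         +-commutativeSemigroup;
         m≤m+n; m≤n+m; m≤n⇒m≤1+n; n≤1+n)
open import Data.Product using (_×_; _,_; proj₁; proj₂)
open import Data.Sum using (_⊎_; inj₁; inj₂)
open import Data.Unit using (⊤; tt)
open import Relation.Binary.PropositionalEquality as ≡ using (_≡_; _≢_; cong; cong₂; sym)
open import Function using (_∘_)
open import Relation.Nullary using (¬_; yes; no)
open import Algebra.Properties.CommutativeSemigroup +-commutativeSemigroup using (x∙yz≈y∙xz)

record LinearInvariant (I : List Formula → Set) : Set where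
  field
    ↭-closed      : ∀ {Γ Δ} → Γ ↭ Δ → I Γ → I Δ
    axiom-closed  : ∀ n → I (var n ∷ neg (var n) ∷ [])
    with-closed   : ∀ {Γ A B} → I (A ∷ Γ) → I (B ∷ Γ) → I ((A and B) ∷ Γ)
    tensor-closed : ∀ {Δ Σ A B} → I (A ∷ Δ) → I (B ∷ Σ) → I ((A and B) ∷ Δ ++ Σ)
    oplus₁-closed : ∀ {Γ A B} → I (A ∷ Γ) → I ((A or B) ∷ Γ)
    oplus₂-closed : ∀ {Γ A B} → I (B ∷ Γ) → I ((A or B) ∷ Γ)
    par-closed    : ∀ {Γ A B} → I (A ∷ B ∷ Γ) → I ((A or B) ∷ Γ)

derivable⇒invariant : ∀ {S I} → S Weak ≢ true → S Contr ≢ true → LinearInvariant I →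
                      ∀ {Γ} → Derivable S Γ → I Γ
derivable⇒invariant {S} {I} no-weak no-contr invariant = go
  where
  open LinearInvariant invariant
  go : ∀ {Γ} → Derivable S Γ → I Γ
  go (exch p d)     = ↭-closed p (go d)
  go (axiom n)      = axiom-closed n
  go (with-r _ d e) = with-closed (go d) (go e)
  go (tensor _ d e) = tensor-closed (go d) (go e)
  go (oplus₁ _ d)   = oplus₁-closed (go d)
  go (oplus₂ _ d)   = oplus₂-closed (go d)
  go (par _ d)      = par-closed (go d)
  go (weak w _)     = ⊥-elim (no-weak w)
  go (contr c _)    = ⊥-elim (no-contr c)

size : Formula → ℕ
size (var _)   = 1
size (nvar _)  = 1
size (A and B) = suc (size A + size B)
size (A or B)  = suc (size A + size B)

≤-node-left : ∀ a b w → a + w ≤ suc (a + b) + w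
≤-node-left a b w = +-monoˡ-≤ w (m≤n⇒m≤1+n (m≤m+n a b))

≤-node-right : ∀ a b w → b + w ≤ suc (a + b) + w
≤-node-right a b w = +-monoˡ-≤ w (m≤n⇒m≤1+n (m≤n+m b a))

≤-node-left-split : ∀ a b u v → a + u ≤ suc (a + b) + (u + v)
≤-node-left-split a b u v = ≤-trans (+-monoʳ-≤ a (m≤m+n u v)) (≤-node-left a b (u + v))

≤-node-right-split : ∀ a b u v → b + v ≤ suc (a + b) + (u + v)
≤-node-right-split a b u v = ≤-trans (+-monoʳ-≤ b (m≤n+m v u)) (≤-node-right a b (u + v))

≤-node-both : ∀ a b w → a + (b + w) ≤ suc (a + b) + w
≤-node-both a b w = ≤-trans (≤-reflexive (sym (+-assoc a b w))) (n≤1+n (a + b + w))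

-- Nested pairs rather than Vec: being records, tallies need not be split into
-- constructors before the step lemmas below can match on them.
Counts : ℕ → Set
Counts zero    = ⊤
Counts (suc n) = ℕ × Counts n

zeros : ∀ {n} → Counts n
zeros {zero}  = tt
zeros {suc n} = 0 , zeros

bump : ∀ {n} → Fin n → Counts n → Counts n
bump zero    (x , c) = suc x , c
bump (suc i) (x , c) = x , bump i c

_⊞_ : ∀ {n} → Counts n → Counts n → Counts n
_⊞_ {zero}  _       _       = tt
_⊞_ {suc n} (x , c) (y , d) = x + y , c ⊞ d

bump-comm : ∀ {n} (i j : Fin n) (c : Counts n) → bump i (bump j c) ≡ bump j (bump i c)
bump-comm zero    zero    _       = ≡.refl
bump-comm zero    (suc j) _       = ≡.refl
bump-comm (suc i) zero    _       = ≡.refl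
bump-comm (suc i) (suc j) (x , c) = cong (x ,_) (bump-comm i j c)

bump-⊞ : ∀ {n} (i : Fin n) (c d : Counts n) → bump i c ⊞ d ≡ bump i (c ⊞ d)
bump-⊞ zero    _       _       = ≡.refl
bump-⊞ (suc i) (x , c) (y , d) = cong (x + y ,_) (bump-⊞ i c d)

zeros-⊞ : ∀ {n} (c : Counts n) → zeros ⊞ c ≡ c
zeros-⊞ {zero}  _       = ≡.refl
zeros-⊞ {suc n} (x , c) = cong (x ,_) (zeros-⊞ c)

pattern P  = var 0
pattern Q  = var 1
pattern P̄  = nvar 0
pattern Q̄  = nvar 1
pattern X  = P̄ and Q̄
pattern Y  = P̄ and X
pattern Z  = Q or Y
pattern F  = P or Z

F-valid : Valid F
F-valid ρ with ρ 0 | ρ 1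
... | true  | _     = ≡.refl
... | false | true  = ≡.refl
... | false | false = ≡.refl

data SubF : Formula → Set where
  sP  : SubF P
  sQ  : SubF Q
  sP̄  : SubF P̄
  sQ̄  : SubF Q̄
  sX  : SubF X
  sY  : SubF Y
  sZ  : SubF Z
  sF  : SubF F

and-sub : ∀ {A B} → SubF (A and B) → SubF A × SubF B
and-sub sX = sP̄ , sQ̄
and-sub sY = sP̄ , sX

or-sub : ∀ {A B} → SubF (A or B) → SubF A × SubF B
or-sub sZ = sQ , sY
or-sub sF = sP , sZ

-- Formulas other than subformulas of F never occur in the sequents we tally,
-- so lumping them into class 0 is harmless.
class : Formula → Fin 8
class P  = # 0
class Q  = # 1
class P̄  = # 2
class Q̄  = # 3
class X  = # 4
class Y  = # 5
class Z  = # 6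
class F  = # 7
class _  = # 0

Tally : Set
Tally = Counts 8 × ℕ

add : Formula → Tally → Tally
add A (c , w) = bump (class A) c , size A + w

tally : List Formula → Tally
tally = foldr add (zeros , 0)

_⊕_ : Tally → Tally → Tally
(c , v) ⊕ (d , w) = c ⊞ d , v + w

add-comm : ∀ A B t → add A (add B t) ≡ add B (add A t)
add-comm A B (c , w) = cong₂ _,_ (bump-comm (class A) (class B) c) (x∙yz≈y∙xz (size A) (size B) w)

add-⊕ : ∀ A s t → add A s ⊕ t ≡ add A (s ⊕ t)
add-⊕ A (c , v) (d , w) = cong₂ _,_ (bump-⊞ (class A) c d) (+-assoc (size A) v w)

tally-↭ : ∀ {Γ Δ} → Γ ↭ Δ → tally Γ ≡ tally Δ
tally-↭ refl         = ≡.refl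
tally-↭ (prep A p)   = cong (add A) (tally-↭ p)
tally-↭ (swap A B p) = ≡.trans (add-comm A B _) (cong (λ t → add B (add A t)) (tally-↭ p))
tally-↭ (trans p q)  = ≡.trans (tally-↭ p) (tally-↭ q)

tally-++ : ∀ Δ Σ → tally (Δ ++ Σ) ≡ tally Δ ⊕ tally Σ
tally-++ []      Σ = cong (_, proj₂ (tally Σ)) (sym (zeros-⊞ (proj₁ (tally Σ))))
tally-++ (A ∷ Δ) Σ = ≡.trans (cong (add A) (tally-++ Δ Σ)) (sym (add-⊕ A (tally Δ) (tally Σ)))

weight : Tally → ℕ
weight (_ , w) = w

Light : ℕ → Set
Light w = T (w ≤ᵇ size F)

lighter : ∀ {v w} → v ≤ w → Light w → Light v
lighter {w = w} v≤w light = ≤⇒≤ᵇ (≤-trans v≤w (≤ᵇ⇒≤ w (size F) light))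

data SmallDerivable : Tally → Set where
  ⊢PP̄   : SmallDerivable (tally (P ∷ P̄ ∷ []))
  ⊢QQ̄   : SmallDerivable (tally (Q ∷ Q̄ ∷ []))
  ⊢Q̄Z   : SmallDerivable (tally (Q̄ ∷ Z ∷ []))
  ⊢PQX  : SmallDerivable (tally (P ∷ Q ∷ X ∷ []))
  ⊢PPQY : SmallDerivable (tally (P ∷ P ∷ Q ∷ Y ∷ []))
  ⊢PPZ  : SmallDerivable (tally (P ∷ P ∷ Z ∷ []))

with-step : ∀ {A B} → SubF (A and B) → ∀ c →
            SmallDerivable (add A c) → SmallDerivable (add B c) →
            Light (weight (add (A and B) c)) → SmallDerivable (add (A and B) c)
with-step sX _ ⊢PP̄ ()
with-step sY _ ⊢PP̄ ()

tensor-step : ∀ {A B} → SubF (A and B) → ∀ c d →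
              SmallDerivable (add A c) → SmallDerivable (add B d) →
              Light (weight (add (A and B) (c ⊕ d))) → SmallDerivable (add (A and B) (c ⊕ d))
tensor-step sX _ _ ⊢PP̄ ⊢QQ̄  _  = ⊢PQX
tensor-step sX _ _ ⊢PP̄ ⊢Q̄Z  ()
tensor-step sY _ _ ⊢PP̄ ⊢PQX _  = ⊢PPQY

oplus₁-step : ∀ {A B} → SubF (A or B) → ∀ c →
              SmallDerivable (add A c) →
              Light (weight (add (A or B) c)) → SmallDerivable (add (A or B) c)
oplus₁-step sZ _ ⊢QQ̄   _  = ⊢Q̄Z
oplus₁-step sZ _ ⊢PQX  ()
oplus₁-step sZ _ ⊢PPQY ()
oplus₁-step sF _ ⊢PP̄   ()
oplus₁-step sF _ ⊢PQX  ()
oplus₁-step sF _ ⊢PPQY ()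
oplus₁-step sF _ ⊢PPZ  ()

oplus₂-step : ∀ {A B} → SubF (A or B) → ∀ c →
              SmallDerivable (add B c) →
              Light (weight (add (A or B) c)) → SmallDerivable (add (A or B) c)
oplus₂-step sZ _ ⊢PPQY ()
oplus₂-step sF _ ⊢Q̄Z   ()
oplus₂-step sF _ ⊢PPZ  ()

par-step : ∀ {A B} → SubF (A or B) → ∀ c →
           SmallDerivable (add A (add B c)) →
           Light (weight (add (A or B) c)) → SmallDerivable (add (A or B) c)
par-step sZ _ ⊢PPQY _  = ⊢PPZ
par-step sF _ ⊢PPZ  ()

Good : List Formula → Set
Good Γ = All SubF Γ → Light (weight (tally Γ)) → SmallDerivable (tally Γ)

good-↭ : ∀ {Γ Δ} → Γ ↭ Δ → Good Γ → Good Δ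
good-↭ p good subs light =
  ≡.subst SmallDerivable (tally-↭ p)
    (good (All-resp-↭ (↭-sym p) subs) (≡.subst (Light ∘ weight) (sym (tally-↭ p)) light))

good-axiom : ∀ n → Good (var n ∷ neg (var n) ∷ [])
good-axiom _ (sP ∷ sP̄ ∷ []) _ = ⊢PP̄
good-axiom _ (sQ ∷ sQ̄ ∷ []) _ = ⊢QQ̄

good-with : ∀ {Γ A B} → Good (A ∷ Γ) → Good (B ∷ Γ) → Good ((A and B) ∷ Γ)
good-with {Γ} {A} {B} good₁ good₂ (s ∷ subs) light =
  with-step s (tally Γ)
    (good₁ (proj₁ (and-sub s) ∷ subs) (lighter (≤-node-left (size A) (size B) _) light))
    (good₂ (proj₂ (and-sub s) ∷ subs) (lighter (≤-node-right (size A) (size B) _) light))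
    light

good-tensor : ∀ {Δ Σ A B} → Good (A ∷ Δ) → Good (B ∷ Σ) → Good ((A and B) ∷ Δ ++ Σ)
good-tensor {Δ} {Σ} {A} {B} good₁ good₂ (s ∷ subs) light rewrite tally-++ Δ Σ =
  tensor-step s (tally Δ) (tally Σ)
    (good₁ (proj₁ (and-sub s) ∷ ++⁻ˡ Δ subs) (lighter (≤-node-left-split (size A) (size B) _ _) light))
    (good₂ (proj₂ (and-sub s) ∷ ++⁻ʳ Δ subs) (lighter (≤-node-right-split (size A) (size B) _ _) light))
    light

good-oplus₁ : ∀ {Γ A B} → Good (A ∷ Γ) → Good ((A or B) ∷ Γ)
good-oplus₁ {Γ} {A} {B} good (s ∷ subs) light =
  oplus₁-step s (tally Γ)
    (good (proj₁ (or-sub s) ∷ subs) (lighter (≤-node-left (size A) (size B) _) light))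
    light

good-oplus₂ : ∀ {Γ A B} → Good (B ∷ Γ) → Good ((A or B) ∷ Γ)
good-oplus₂ {Γ} {A} {B} good (s ∷ subs) light =
  oplus₂-step s (tally Γ)
    (good (proj₂ (or-sub s) ∷ subs) (lighter (≤-node-right (size A) (size B) _) light))
    light

good-par : ∀ {Γ A B} → Good (A ∷ B ∷ Γ) → Good ((A or B) ∷ Γ)
good-par {Γ} {A} {B} good (s ∷ subs) light =
  par-step s (tally Γ)
    (good (proj₁ (or-sub s) ∷ proj₂ (or-sub s) ∷ subs) (lighter (≤-node-both (size A) (size B) _) light))
    light

good-invariant : LinearInvariant Good
good-invariant = record
  { ↭-closed      = good-↭
  ; axiom-closed  = good-axiom
  ; with-closed   = good-with
  ; tensor-closed = good-tensor
  ; oplus₁-closed = good-oplus₁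
  ; oplus₂-closed = good-oplus₂
  ; par-closed    = good-par
  }

F-not-small : ¬ SmallDerivable (tally (F ∷ []))
F-not-small ()

F-underivable : ∀ {S} → S Weak ≢ true → S Contr ≢ true → ¬ Derivable S (F ∷ [])
F-underivable no-weak no-contr d =
  F-not-small (derivable⇒invariant no-weak no-contr good-invariant d (sF ∷ []) _)

lemma18 : (S : System) → Complete S → S Contr ≡ true ⊎ S Weak ≡ true
lemma18 S complete with S Contr ≟ true | S Weak ≟ true
... | yes has-contr | _            = inj₁ has-contr
... | no _          | yes has-weak = inj₂ has-weak
... | no no-contr   | no no-weak   = ⊥-elim (F-underivable no-weak no-contr (complete F F-valid))
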